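{- For every integer $k\ge4$ there exists a discrete probability distribution $P=(a_1/m,\dots,a_n/m)$, with $a_i$ coprime positive integers and $\lceil\log m\rceil=k$ (so that $\mathrm{FLDR}[P]$ has depth $k$), such that the entropy tolls satisfy $\tau(\mathrm{ALDR}[P,K])>2$ for every $K\in\{k,k+1,\dots,2k-1\}$.
   Context: All logarithms are base 2; $H(P)$ is Shannon entropy. For real $x\ge0$ and integer $d$, $\epsilon_d(x)=\lfloor 2^d x\rfloor\bmod 2$, $\nu(x)=\sum_d d\,\epsilon_d(x)2^{ -d}$. A DDG tree is a sampler driven by i.i.d. fair bits: a binary tree (possibly with back edges to the root) with labeled leaves, traversed from the root one fair bit per step until a leaf is reached, whose label is output. $C(T)$ is the number of bits consumed; toll $\tau(T)=\mathbb{E}[C(T)]-H(P_T)$, $P_T$ the output distribution. FLDR: for positive integers $A_1,\dots,A_n$ with sum $M$, $K'=\lceil\log M\rceil$, $A_0=2^{K'}-M$, $Q=(A_0/2^{K'},\dots,A_n/2^{K'})$; $\mathrm{FLDR}[A_1,\dots,A_n]$ is an entropy-optimal DDG tree for $Q$ (exactly $\epsilon_d(A_i/2^{K'})$ leaves labeled $i$ at depth $d$) with each leaf labeled $0$ replaced by a back edge to the root; output distribution $(A_i/M)$, expected cost $(2^{K'}/M)\sum_{i=0}^n\nu(A_i/2^{K'})$. For $P=(a_i/m)$ with $\gcd(a_1,\dots,a_n)=1$, $m=\sum a_i$, $k=\lceil\log m\rceil$ and integer $K\ge k$: $c_K=\lfloor 2^K/m\rfloor$, $\mathrm{ALDR}[P,K]=\mathrm{FLDR}[c_Ka_1,\dots,c_Ka_n]$,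 and $\mathrm{FLDR}[P]=\mathrm{FLDR}[a_1,\dots,a_n]=\mathrm{ALDR}[P,k]$. -}

module Defs where

open import Data.Nat using (ℕ; zero; suc; _+_; _*_; _∸_; _^_; _<_; _%_; _/_; ⌊_/2⌋)
open import Data.Nat.Logarithm using (⌈log₂_⌉)
open import Data.Nat.GCD using (gcd)
open import Data.List using (List; []; _∷_; map; foldr)
open import Data.Nat.ListAction using (sum; product)

sumFrom1 : ℕ → (ℕ → ℕ) → ℕ
sumFrom1 zero    f = 0
sumFrom1 (suc K) f = sumFrom1 K f + f (suc K)

shiftR : ℕ → ℕ → ℕ
shiftR zero    A = A
shiftR (suc j) A = ⌊ shiftR j A /2⌋

-- ε_d(A / 2^K) = ⌊2^d A / 2^K⌋ mod 2 = ⌊A / 2^(K-d)⌋ mod 2, for 1 ≤ d ≤ K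
-- (for d > K the digit of a dyadic with denominator 2^K is 0, and d ≤ 0
--  contributes d·ε_d·2^{-d} = 0 whenever A ≤ 2^K)
digit : (K A d : ℕ) → ℕ
digit K A d = shiftR (K ∸ d) A % 2

-- 2^K · ν(A / 2^K)  =  Σ_{d=1}^{K} d · ε_d(A/2^K) · 2^(K-d)   (valid for A ≤ 2^K)
scaledNu : (K A : ℕ) → ℕ
scaledNu K A = sumFrom1 K (λ d → d * digit K A d * 2 ^ (K ∸ d))

totalM : List ℕ → ℕ
totalM As = sum As

depthK' : List ℕ → ℕ
depthK' As = ⌈log₂ totalM As ⌉

rejectA0 : List ℕ → ℕ
rejectA0 As = 2 ^ depthK' As ∸ totalM As

-- M · E[C(FLDR[A])] = 2^K' Σ_{i=0}^{n} ν(A_i / 2^K')   (the expected-cost formula)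
fldrCostTimesM : List ℕ → ℕ
fldrCostTimesM As = sum (map (scaledNu (depthK' As)) (rejectA0 As ∷ As))

selfPowProd : List ℕ → ℕ
selfPowProd As = product (map (λ a → a ^ a) As)

-- τ(FLDR[A]) > 2.  With S = M·E[C] and output distribution (A_i/M),
--   E[C] - H > 2  ⇔  S - M log M + Σ A_i log A_i > 2M
--                ⇔  2^(2M) · M^M < 2^S · Π A_i^{A_i}
-- (exponentiating base 2, which is strictly monotone), an inequality of naturals.
FLDRTollGt2 : List ℕ → Set
FLDRTollGt2 As = 2 ^ (2 * M) * M ^ M < 2 ^ fldrCostTimesM As * selfPowProd As
  where M = totalM As

cK : (K m : ℕ) → ℕ
cK K zero    = 0
cK K (suc m) = 2 ^ K / suc m

-- ALDR[P,K] = FLDR[c_K a_1, …, c_K a_n] with m = Σ a_i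
ALDRTollGt2 : (as : List ℕ) (K : ℕ) → Set
ALDRTollGt2 as K = FLDRTollGt2 (map (cK K (sum as) *_) as)

gcdList : List ℕ → ℕ
gcdList = foldr gcd 0

-- Take m = 2^k − 3 and P = (2O, 2O + 1)/m with O = 2^(k−2) − 1.  Reading the FLDR digits of
-- A₀ = 3, 2O and 2O + 1 off their binary expansions, FLDR[P] consumes exactly 3(m + 1)/m bits on
-- average, and its toll exceeds 2 iff m^m < 2^(m+3) (2O)^(2O) (2O+1)^(2O+1), which follows from
-- Bernoulli's inequality.  For K = k + j with j ≤ k − 2 we get c_K = 2^j, and doubling every weight
-- only deepens the tree by one level, so ALDR[P,K] has the same cost.  At K = 2k − 1 we get
-- c_K = 2^(k−1) + 1, and the weights c_K·2O, c_K·(2O + 1) and the new A₀ again have explicit binary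
-- expansions that give the cost 3(m + 1)/m.  Since the output distribution is always P, the toll
-- stays above 2.
{-# OPTIONS --safe #-}
module Submission where

open import Data.List using (List; []; _∷_; map)
open import Data.List.Relation.Unary.All using (All; []; _∷_)
open import Data.Nat
open import Data.Nat.Coprimality
  using (Coprime; 1-coprimeTo; coprime-+; coprime⇒gcd≡1) renaming (sym to coprime-sym)
open import Data.Nat.DivMod
open import Data.Nat.Divisibility using (n∣m*n)
open import Data.Nat.GCD using (gcd; gcd-identityʳ)
open import Data.Nat.ListAction using (sum)
open import Data.Nat.Logarithm
open import Data.Nat.Properties
open import Algebra.Properties.CommutativeSemigroup *-commutativeSemigroup
  using (interchange; x∙yz≈y∙xz; x∙yz≈yx∙z; xy∙z≈y∙xz)
open import Data.Nat.Tactic.RingSolver using (solve-∀)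
open import Data.Product using (∃; ∃₂; _×_; _,_)
open import Data.Sum using (inj₁; inj₂)
open import Relation.Binary.PropositionalEquality

open import Defs

open ≤-Reasoning

shiftR-suc : ∀ j A → shiftR (suc j) A ≡ shiftR j ⌊ A /2⌋
shiftR-suc zero    A = refl
shiftR-suc (suc j) A = cong ⌊_/2⌋ (shiftR-suc j A)

sumFrom1-cong : ∀ K {f g : ℕ → ℕ} → (∀ d → d ≤ K → f d ≡ g d) → sumFrom1 K f ≡ sumFrom1 K g
sumFrom1-cong zero    f≗g = refl
sumFrom1-cong (suc K) f≗g =
  cong₂ _+_ (sumFrom1-cong K (λ d d≤K → f≗g d (m≤n⇒m≤1+n d≤K))) (f≗g (suc K) ≤-refl)

*-distribˡ-sumFrom1 : ∀ K c (f : ℕ → ℕ) → sumFrom1 K (λ d → c * f d) ≡ c * sumFrom1 K f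
*-distribˡ-sumFrom1 zero    c f = sym (*-zeroʳ c)
*-distribˡ-sumFrom1 (suc K) c f = begin-equality
  sumFrom1 K (λ d → c * f d) + c * f (suc K) ≡⟨ cong (_+ c * f (suc K)) (*-distribˡ-sumFrom1 K c f) ⟩
  c * sumFrom1 K f + c * f (suc K)           ≡⟨ *-distribˡ-+ c (sumFrom1 K f) (f (suc K)) ⟨
  c * (sumFrom1 K f + f (suc K))             ∎

⌊b+2*c/2⌋≡c : ∀ {b} c → b ≤ 1 → ⌊ b + 2 * c /2⌋ ≡ c
⌊b+2*c/2⌋≡c c z≤n       = trans (cong ⌊_/2⌋ (cong (c +_) (+-identityʳ c))) (sym (n≡⌊n+n/2⌋ c))
⌊b+2*c/2⌋≡c c (s≤s z≤n) = trans (cong (λ x → ⌊ suc (c + x) /2⌋) (+-identityʳ c)) (sym (n≡⌈n+n/2⌉ c))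

[b+2*c]%2≡b : ∀ {b} c → b ≤ 1 → (b + 2 * c) % 2 ≡ b
[b+2*c]%2≡b {b} c b≤1 = begin-equality
  (b + 2 * c) % 2 ≡⟨ cong (λ x → (b + x) % 2) (*-comm 2 c) ⟩
  (b + c * 2) % 2 ≡⟨ [m+kn]%n≡m%n b c 2 ⟩
  b % 2           ≡⟨ m<n⇒m%n≡m (s≤s b≤1) ⟩
  b               ∎

lowestBit : ∀ B → ∃₂ λ b C → b ≤ 1 × B ≡ b + 2 * C
lowestBit B = B % 2 , B / 2 , ≤-pred (m%n<n B 2) ,
  trans (m≡m%n+[m/n]*n B 2) (cong (B % 2 +_) (*-comm (B / 2) 2))

-- Appending the binary digit b below C moves every digit of C one level deeper.
scaledNu-suc : ∀ K {b} C → b ≤ 1 → scaledNu (suc K) (b + 2 * C) ≡ 2 * scaledNu K C + suc K * b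
scaledNu-suc K {b} C b≤1 = cong₂ _+_ shifted lowest
  where
  A : ℕ
  A = b + 2 * C
  digit-shift : ∀ d → d ≤ K → d * digit (suc K) A d * 2 ^ (suc K ∸ d) ≡ 2 * (d * digit K C d * 2 ^ (K ∸ d))
  digit-shift d d≤K
    rewrite +-∸-assoc 1 d≤K | shiftR-suc (K ∸ d) A | ⌊b+2*c/2⌋≡c C b≤1 =
    rearrange d (shiftR (K ∸ d) C % 2) (2 ^ (K ∸ d))
    where
    rearrange : ∀ x y z → x * y * (2 * z) ≡ 2 * (x * y * z)
    rearrange = solve-∀
  shifted : sumFrom1 K (λ d → d * digit (suc K) A d * 2 ^ (suc K ∸ d)) ≡ 2 * scaledNu K C
  shifted = trans (sumFrom1-cong K digit-shift) (*-distribˡ-sumFrom1 K 2 _)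
  lowest : suc K * digit (suc K) A (suc K) * 2 ^ (suc K ∸ suc K) ≡ suc K * b
  lowest rewrite n∸n≡0 K | [b+2*c]%2≡b C b≤1 = *-identityʳ _

scaledNu-zero : ∀ K → scaledNu K 0 ≡ 0
scaledNu-zero zero    = refl
scaledNu-zero (suc K) = begin-equality
  scaledNu (suc K) 0         ≡⟨ scaledNu-suc K 0 z≤n ⟩
  2 * scaledNu K 0 + suc K * 0 ≡⟨ cong₂ (λ x y → 2 * x + y) (scaledNu-zero K) (*-zeroʳ (suc K)) ⟩
  0                          ∎

scaledNu-split : ∀ j K A B → B < 2 ^ j →
  scaledNu (j + K) (A * 2 ^ j + B) ≡ 2 ^ j * scaledNu K A + scaledNu j B + K * B
scaledNu-split zero K A .0 (s≤s z≤n) = begin-equality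
  scaledNu K (A * 1 + 0)          ≡⟨ cong (scaledNu K) (trans (+-identityʳ _) (*-identityʳ A)) ⟩
  scaledNu K A                    ≡⟨ pad (scaledNu K A) K ⟨
  1 * scaledNu K A + 0 + K * 0    ∎
  where
  pad : ∀ x K → 1 * x + 0 + K * 0 ≡ x
  pad = solve-∀
scaledNu-split (suc j) K A B B<2^[1+j] with lowestBit B
... | b , C , b≤1 , refl = begin-equality
  scaledNu (suc j + K) (A * 2 ^ suc j + (b + 2 * C))
    ≡⟨ cong (scaledNu (suc j + K)) (regroup A (2 ^ j) b C) ⟩
  scaledNu (suc (j + K)) (b + 2 * (A * 2 ^ j + C))
    ≡⟨ scaledNu-suc (j + K) _ b≤1 ⟩
  2 * scaledNu (j + K) (A * 2 ^ j + C) + suc (j + K) * b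
    ≡⟨ cong (λ x → 2 * x + suc (j + K) * b) (scaledNu-split j K A C C<2^j) ⟩
  2 * (2 ^ j * scaledNu K A + scaledNu j C + K * C) + suc (j + K) * b
    ≡⟨ distribute (2 ^ j) (scaledNu K A) (scaledNu j C) K C j b ⟩
  2 ^ suc j * scaledNu K A + (2 * scaledNu j C + suc j * b) + K * (b + 2 * C)
    ≡⟨ cong (λ x → 2 ^ suc j * scaledNu K A + x + K * (b + 2 * C)) (scaledNu-suc j C b≤1) ⟨
  2 ^ suc j * scaledNu K A + scaledNu (suc j) (b + 2 * C) + K * (b + 2 * C) ∎
  where
  regroup : ∀ A p b C → A * (2 * p) + (b + 2 * C) ≡ b + 2 * (A * p + C)
  regroup = solve-∀
  distribute : ∀ p x y K C j b →
    2 * (p * x + y + K * C) + suc (j + K) * b ≡ (2 * p) * x + (2 * y + suc j * b) + K * (b + 2 * C)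
  distribute = solve-∀
  C<2^j : C < 2 ^ j
  C<2^j = *-cancelˡ-< 2 C (2 ^ j) (≤-trans (s≤s (m≤n+m (2 * C) b)) B<2^[1+j])

scaledNu-*2^ : ∀ j K A → scaledNu (j + K) (2 ^ j * A) ≡ 2 ^ j * scaledNu K A
scaledNu-*2^ j K A = begin-equality
  scaledNu (j + K) (2 ^ j * A)
    ≡⟨ cong (scaledNu (j + K)) (trans (*-comm (2 ^ j) A) (sym (+-identityʳ _))) ⟩
  scaledNu (j + K) (A * 2 ^ j + 0)
    ≡⟨ scaledNu-split j K A 0 (m^n>0 2 j) ⟩
  2 ^ j * scaledNu K A + scaledNu j 0 + K * 0
    ≡⟨ cong₂ (λ x y → 2 ^ j * scaledNu K A + x + y) (scaledNu-zero j) (*-zeroʳ K) ⟩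
  2 ^ j * scaledNu K A + 0 + 0
    ≡⟨ trans (+-identityʳ _) (+-identityʳ _) ⟩
  2 ^ j * scaledNu K A ∎

scaledNu-pad : ∀ j K B → B < 2 ^ j → scaledNu (j + K) B ≡ scaledNu j B + K * B
scaledNu-pad j K B B<2^j = begin-equality
  scaledNu (j + K) (0 * 2 ^ j + B)
    ≡⟨ scaledNu-split j K 0 B B<2^j ⟩
  2 ^ j * scaledNu K 0 + scaledNu j B + K * B
    ≡⟨ cong (λ x → 2 ^ j * x + scaledNu j B + K * B) (scaledNu-zero K) ⟩
  2 ^ j * 0 + scaledNu j B + K * B
    ≡⟨ cong (λ x → x + scaledNu j B + K * B) (*-zeroʳ (2 ^ j)) ⟩
  scaledNu j B + K * B ∎

scaledNu-1 : ∀ K → scaledNu (suc K) 1 ≡ suc K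
scaledNu-1 K = trans (scaledNu-pad 1 K 1 (s≤s (s≤s z≤n))) (cong suc (*-identityʳ K))

scaledNu-3 : ∀ K → 1 ≤ K → scaledNu (suc K) 3 ≡ 3 * K + 1
scaledNu-3 (suc K) _ = trans (scaledNu-pad 2 K 3 (s≤s (s≤s (s≤s (s≤s z≤n))))) (digits K)
  where
  digits : ∀ K → 4 + K * 3 ≡ 3 * suc K + 1
  digits = solve-∀

mersenne : ℕ → ℕ
mersenne zero    = 0
mersenne (suc r) = 1 + 2 * mersenne r

suc-mersenne : ∀ r → suc (mersenne r) ≡ 2 ^ r
suc-mersenne zero    = refl
suc-mersenne (suc r) = trans (step (mersenne r)) (cong (2 *_) (suc-mersenne r))
  where
  step : ∀ x → suc (1 + 2 * x) ≡ 2 * suc x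
  step = solve-∀

scaledNu-mersenne : ∀ r → scaledNu r (mersenne r) + r ≡ 2 * mersenne r
scaledNu-mersenne zero    = refl
scaledNu-mersenne (suc r) = begin-equality
  scaledNu (suc r) (1 + 2 * mersenne r) + suc r     ≡⟨ cong (_+ suc r) (scaledNu-suc r (mersenne r) (s≤s z≤n)) ⟩
  2 * scaledNu r (mersenne r) + suc r * 1 + suc r   ≡⟨ regroup (scaledNu r (mersenne r)) r ⟩
  2 + 2 * (scaledNu r (mersenne r) + r)             ≡⟨ cong (λ x → 2 + 2 * x) (scaledNu-mersenne r) ⟩
  2 + 2 * (2 * mersenne r)                          ≡⟨ regroup′ (mersenne r) ⟩
  2 * (1 + 2 * mersenne r)                          ∎
  where
  regroup : ∀ s r → 2 * s + suc r * 1 + suc r ≡ 2 + 2 * (s + r)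
  regroup = solve-∀
  regroup′ : ∀ x → 2 + 2 * (2 * x) ≡ 2 * (1 + 2 * x)
  regroup′ = solve-∀

⌈log₂2^j*n⌉≡j+⌈log₂n⌉ : ∀ j n .{{_ : NonZero n}} → ⌈log₂ (2 ^ j * n) ⌉ ≡ j + ⌈log₂ n ⌉
⌈log₂2^j*n⌉≡j+⌈log₂n⌉ zero    n = cong ⌈log₂_⌉ (*-identityˡ n)
⌈log₂2^j*n⌉≡j+⌈log₂n⌉ (suc j) n = begin-equality
  ⌈log₂ (2 * 2 ^ j * n) ⌉   ≡⟨ cong ⌈log₂_⌉ (*-assoc 2 (2 ^ j) n) ⟩
  ⌈log₂ (2 * (2 ^ j * n)) ⌉ ≡⟨ ⌈log₂2*n⌉≡1+⌈log₂n⌉ (2 ^ j * n) {{m*n≢0 (2 ^ j) n {{m^n≢0 2 j}}}} ⟩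
  suc ⌈log₂ (2 ^ j * n) ⌉   ≡⟨ cong suc (⌈log₂2^j*n⌉≡j+⌈log₂n⌉ j n) ⟩
  suc (j + ⌈log₂ n ⌉)       ∎

⌈log₂1+2^k⌉≡1+k : ∀ k → ⌈log₂ suc (2 ^ k) ⌉ ≡ suc k
⌈log₂1+2^k⌉≡1+k zero    = refl
⌈log₂1+2^k⌉≡1+k (suc k) = ∸1≡1+k⇒≡2+k (begin-equality
  ⌈log₂ suc (2 ^ suc k) ⌉ ∸ 1        ≡⟨ ⌈log₂⌈n/2⌉⌉≡⌈log₂n⌉∸1 (suc (2 ^ suc k)) ⟨
  ⌈log₂ ⌈ suc (2 ^ suc k) /2⌉ ⌉      ≡⟨ cong (λ x → ⌈log₂ suc x ⌉) (⌊b+2*c/2⌋≡c (2 ^ k) z≤n) ⟩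
  ⌈log₂ suc (2 ^ k) ⌉                ≡⟨ ⌈log₂1+2^k⌉≡1+k k ⟩
  suc k                              ∎)
  where
  ∸1≡1+k⇒≡2+k : ∀ {n} → n ∸ 1 ≡ suc k → n ≡ suc (suc k)
  ∸1≡1+k⇒≡2+k {suc n} eq = cong suc eq

⌈log₂n⌉≡1+k : ∀ k {n} → 2 ^ k < n → n ≤ 2 ^ suc k → ⌈log₂ n ⌉ ≡ suc k
⌈log₂n⌉≡1+k k 2^k<n n≤2^[1+k] = ≤-antisym
  (subst (_ ≤_) (⌈log₂2^n⌉≡n (suc k)) (⌈log₂⌉-mono-≤ n≤2^[1+k]))
  (subst (_≤ _) (⌈log₂1+2^k⌉≡1+k k) (⌈log₂⌉-mono-≤ 2^k<n))

[q*n+r]/n≡q : ∀ q {r} n .{{_ : NonZero n}} → r < n → (q * n + r) / n ≡ q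
[q*n+r]/n≡q q {r} n r<n = begin-equality
  (q * n + r) / n     ≡⟨ +-distrib-/-∣ˡ r (n∣m*n q) ⟩
  q * n / n + r / n   ≡⟨ cong₂ _+_ (m*n/n≡m q n) (m<n⇒m/n≡0 r<n) ⟩
  q + 0               ≡⟨ +-identityʳ q ⟩
  q                   ∎

cK-≡ : ∀ {K m} q {r} → 2 ^ K ≡ q * m + r → r < m → cK K m ≡ q
cK-≡ {m = suc m} q eq r<m = trans (/-congˡ eq) ([q*n+r]/n≡q q (suc m) r<m)

sum-map-*ˡ : ∀ c As → sum (map (c *_) As) ≡ c * sum As
sum-map-*ˡ c []       = sym (*-zeroʳ c)
sum-map-*ˡ c (A ∷ As) = trans (cong (c * A +_) (sum-map-*ˡ c As)) (sym (*-distribˡ-+ c A (sum As)))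

sum-map-scaledNu-*2^ : ∀ j K As →
  sum (map (scaledNu (j + K)) (map (2 ^ j *_) As)) ≡ 2 ^ j * sum (map (scaledNu K) As)
sum-map-scaledNu-*2^ j K []       = sym (*-zeroʳ (2 ^ j))
sum-map-scaledNu-*2^ j K (A ∷ As) = begin-equality
  scaledNu (j + K) (2 ^ j * A) + sum (map (scaledNu (j + K)) (map (2 ^ j *_) As))
    ≡⟨ cong₂ _+_ (scaledNu-*2^ j K A) (sum-map-scaledNu-*2^ j K As) ⟩
  2 ^ j * scaledNu K A + 2 ^ j * sum (map (scaledNu K) As)
    ≡⟨ *-distribˡ-+ (2 ^ j) (scaledNu K A) _ ⟨
  2 ^ j * sum (map (scaledNu K) (A ∷ As)) ∎

fldrCostTimesM-≡ : ∀ As {K} A₀ → ⌈log₂ sum As ⌉ ≡ K → 2 ^ K ≡ sum As + A₀ →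
  fldrCostTimesM As ≡ sum (map (scaledNu K) (A₀ ∷ As))
fldrCostTimesM-≡ As {K} A₀ refl 2^K≡M+A₀ =
  cong (λ A → sum (map (scaledNu K) (A ∷ As))) (trans (cong (_∸ sum As) 2^K≡M+A₀) (m+n∸m≡n (sum As) A₀))

fldrCostTimesM-*2^ : ∀ j As .{{_ : NonZero (sum As)}} →
  fldrCostTimesM (map (2 ^ j *_) As) ≡ 2 ^ j * fldrCostTimesM As
fldrCostTimesM-*2^ j As = begin-equality
  fldrCostTimesM (map (2 ^ j *_) As)
    ≡⟨ cong₂ (λ K A₀ → sum (map (scaledNu K) (A₀ ∷ map (2 ^ j *_) As))) depth reject ⟩
  sum (map (scaledNu (j + depthK' As)) (map (2 ^ j *_) (rejectA0 As ∷ As)))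
    ≡⟨ sum-map-scaledNu-*2^ j (depthK' As) (rejectA0 As ∷ As) ⟩
  2 ^ j * fldrCostTimesM As ∎
  where
  depth : depthK' (map (2 ^ j *_) As) ≡ j + depthK' As
  depth = trans (cong ⌈log₂_⌉ (sum-map-*ˡ (2 ^ j) As)) (⌈log₂2^j*n⌉≡j+⌈log₂n⌉ j (sum As))
  reject : rejectA0 (map (2 ^ j *_) As) ≡ 2 ^ j * rejectA0 As
  reject = begin-equality
    2 ^ depthK' (map (2 ^ j *_) As) ∸ sum (map (2 ^ j *_) As)
      ≡⟨ cong₂ (λ K M → 2 ^ K ∸ M) depth (sum-map-*ˡ (2 ^ j) As) ⟩
    2 ^ (j + depthK' As) ∸ 2 ^ j * sum As
      ≡⟨ cong (_∸ 2 ^ j * sum As) (^-distribˡ-+-* 2 j (depthK' As)) ⟩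
    2 ^ j * 2 ^ depthK' As ∸ 2 ^ j * sum As
      ≡⟨ *-distribˡ-∸ (2 ^ j) (2 ^ depthK' As) (sum As) ⟨
    2 ^ j * rejectA0 As ∎

-- FLDRTollGt2 As is TollGt2 As (fldrCostTimesM As): the toll condition for any sampler of
-- (A_i / M) whose expected cost, multiplied by M, is S.
TollGt2 : List ℕ → ℕ → Set
TollGt2 As S = 2 ^ (2 * totalM As) * totalM As ^ totalM As < 2 ^ S * selfPowProd As

^-distribʳ-* : ∀ m n o → (m * n) ^ o ≡ m ^ o * n ^ o
^-distribʳ-* m n zero    = refl
^-distribʳ-* m n (suc o) = begin-equality
  m * n * (m * n) ^ o      ≡⟨ cong (m * n *_) (^-distribʳ-* m n o) ⟩
  m * n * (m ^ o * n ^ o)  ≡⟨ interchange m n (m ^ o) (n ^ o) ⟩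
  m * m ^ o * (n * n ^ o)  ∎

[c*a]^[c*a]≡c^[c*a]*[a^a]^c : ∀ c a → (c * a) ^ (c * a) ≡ c ^ (c * a) * (a ^ a) ^ c
[c*a]^[c*a]≡c^[c*a]*[a^a]^c c a = begin-equality
  (c * a) ^ (c * a)       ≡⟨ ^-distribʳ-* c a (c * a) ⟩
  c ^ (c * a) * a ^ (c * a) ≡⟨ cong (λ e → c ^ (c * a) * a ^ e) (*-comm c a) ⟩
  c ^ (c * a) * a ^ (a * c) ≡⟨ cong (c ^ (c * a) *_) (^-*-assoc a a c) ⟨
  c ^ (c * a) * (a ^ a) ^ c ∎

selfPowProd-map-* : ∀ c As → selfPowProd (map (c *_) As) ≡ c ^ (c * sum As) * selfPowProd As ^ c
selfPowProd-map-* c []       = sym (cong₂ (λ e x → c ^ e * x) (*-zeroʳ c) (^-zeroˡ c))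
selfPowProd-map-* c (A ∷ As) = begin-equality
  (c * A) ^ (c * A) * selfPowProd (map (c *_) As)
    ≡⟨ cong₂ _*_ ([c*a]^[c*a]≡c^[c*a]*[a^a]^c c A) (selfPowProd-map-* c As) ⟩
  c ^ (c * A) * (A ^ A) ^ c * (c ^ (c * sum As) * selfPowProd As ^ c)
    ≡⟨ interchange (c ^ (c * A)) ((A ^ A) ^ c) (c ^ (c * sum As)) (selfPowProd As ^ c) ⟩
  c ^ (c * A) * c ^ (c * sum As) * ((A ^ A) ^ c * selfPowProd As ^ c)
    ≡⟨ cong₂ _*_ (^-distribˡ-+-* c (c * A) (c * sum As)) (^-distribʳ-* (A ^ A) (selfPowProd As) c) ⟨
  c ^ (c * A + c * sum As) * (A ^ A * selfPowProd As) ^ c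
    ≡⟨ cong (λ e → c ^ e * (A ^ A * selfPowProd As) ^ c) (*-distribˡ-+ c A (sum As)) ⟨
  c ^ (c * (A + sum As)) * (A ^ A * selfPowProd As) ^ c ∎

-- The distribution (A_i / M) and the expected cost S / M are invariant under scaling by c.
TollGt2-* : ∀ c As S .{{_ : NonZero c}} → TollGt2 As S → TollGt2 (map (c *_) As) (c * S)
TollGt2-* c As S tollGt2 = begin-strict
  2 ^ (2 * sum (map (c *_) As)) * sum (map (c *_) As) ^ sum (map (c *_) As)
    ≡⟨ cong (λ N → 2 ^ (2 * N) * N ^ N) (sum-map-*ˡ c As) ⟩
  2 ^ (2 * (c * M)) * (c * M) ^ (c * M)
    ≡⟨ cong₂ _*_ 2^[2cM] ([c*a]^[c*a]≡c^[c*a]*[a^a]^c c M) ⟩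
  (2 ^ (2 * M)) ^ c * (c ^ (c * M) * (M ^ M) ^ c)
    ≡⟨ x∙yz≈y∙xz ((2 ^ (2 * M)) ^ c) (c ^ (c * M)) ((M ^ M) ^ c) ⟩
  c ^ (c * M) * ((2 ^ (2 * M)) ^ c * (M ^ M) ^ c)
    ≡⟨ cong (c ^ (c * M) *_) (^-distribʳ-* (2 ^ (2 * M)) (M ^ M) c) ⟨
  c ^ (c * M) * (2 ^ (2 * M) * M ^ M) ^ c
    <⟨ *-monoʳ-< (c ^ (c * M)) {{m^n≢0 c (c * M)}} (^-monoˡ-< c tollGt2) ⟩
  c ^ (c * M) * (2 ^ S * selfPowProd As) ^ c
    ≡⟨ cong (c ^ (c * M) *_) (^-distribʳ-* (2 ^ S) (selfPowProd As) c) ⟩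
  c ^ (c * M) * ((2 ^ S) ^ c * selfPowProd As ^ c)
    ≡⟨ x∙yz≈y∙xz (c ^ (c * M)) ((2 ^ S) ^ c) (selfPowProd As ^ c) ⟩
  (2 ^ S) ^ c * (c ^ (c * M) * selfPowProd As ^ c)
    ≡⟨ cong₂ _*_ 2^[cS] (selfPowProd-map-* c As) ⟨
  2 ^ (c * S) * selfPowProd (map (c *_) As) ∎
  where
  M : ℕ
  M = sum As
  2^[2cM] : 2 ^ (2 * (c * M)) ≡ (2 ^ (2 * M)) ^ c
  2^[2cM] = trans (cong (2 ^_) (trans (x∙yz≈y∙xz 2 c M) (*-comm c (2 * M))))
                  (sym (^-*-assoc 2 (2 * M) c))
  2^[cS] : 2 ^ (c * S) ≡ (2 ^ S) ^ c
  2^[cS] = trans (cong (2 ^_) (*-comm c S)) (sym (^-*-assoc 2 S c))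

FLDRTollGt2-*2^ : ∀ j As .{{_ : NonZero (sum As)}} → FLDRTollGt2 As → FLDRTollGt2 (map (2 ^ j *_) As)
FLDRTollGt2-*2^ j As tollGt2 =
  subst (TollGt2 (map (2 ^ j *_) As)) (sym (fldrCostTimesM-*2^ j As))
    (TollGt2-* (2 ^ j) As (fldrCostTimesM As) {{m^n≢0 2 j}} tollGt2)

m+o≡n⇒m≤n : ∀ {m n} o → m + o ≡ n → m ≤ n
m+o≡n⇒m≤n {m} o m+o≡n = ≤-trans (m≤m+n m o) (≤-reflexive m+o≡n)

-- (1 + 1/y)^i ≤ y/(y − i), a form of Bernoulli's inequality, cleared of denominators.
bernoulli : ∀ y i d → i + d ≡ y → suc y ^ i * d ≤ y ^ suc i
bernoulli y zero    d d≡y = ≤-reflexive (trans (+-identityʳ d) (trans d≡y (sym (*-identityʳ y))))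
bernoulli y (suc i) d i+1+d≡y = begin
  suc y * suc y ^ i * d     ≡⟨ xy∙z≈y∙xz (suc y) (suc y ^ i) d ⟩
  suc y ^ i * (suc y * d)   ≤⟨ *-monoʳ-≤ (suc y ^ i) (+-mono-≤ d≤y (≤-reflexive (*-comm y d))) ⟩
  suc y ^ i * (suc d * y)   ≡⟨ *-assoc (suc y ^ i) (suc d) y ⟨
  suc y ^ i * suc d * y     ≤⟨ *-monoˡ-≤ y (bernoulli y i (suc d) (trans (+-suc i d) i+1+d≡y)) ⟩
  y ^ suc i * y             ≡⟨ *-comm (y ^ suc i) y ⟩
  y ^ suc (suc i)           ∎
  where
  d≤y : d ≤ y
  d≤y = subst (d ≤_) i+1+d≡y (m≤n+m d (suc i))

[1+4n[1+n]]^n≤8*[4n[1+n]]^n : ∀ n → suc (4 * (n * suc n)) ^ n ≤ 8 * (4 * (n * suc n)) ^ n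
[1+4n[1+n]]^n≤8*[4n[1+n]]^n zero        = s≤s z≤n
[1+4n[1+n]]^n≤8*[4n[1+n]]^n n@(suc _) = *-cancelʳ-≤ (suc y ^ n) (8 * y ^ n) d (begin
  suc y ^ n * d   ≤⟨ bernoulli y n d (n+d≡y n) ⟩
  y * y ^ n       ≡⟨ *-comm y (y ^ n) ⟩
  y ^ n * y       ≤⟨ *-monoʳ-≤ (y ^ n) (m+o≡n⇒m≤n _ (y+d′≡8d n)) ⟩
  y ^ n * (8 * d) ≡⟨ x∙yz≈yx∙z (y ^ n) 8 d ⟩
  8 * y ^ n * d   ∎)
  where
  y d : ℕ
  y = 4 * (n * suc n)
  d = n * (4 * n + 3)
  n+d≡y : ∀ n → n + n * (4 * n + 3) ≡ 4 * (n * suc n)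
  n+d≡y = solve-∀
  y+d′≡8d : ∀ n → 4 * (n * suc n) + n * (28 * n + 20) ≡ 8 * (n * (4 * n + 3))
  y+d′≡8d = solve-∀

[1+2n]^[1+2n]<2^[4+2n]*n^n*[1+n]^[1+n] : ∀ n →
  suc (2 * n) ^ suc (2 * n) < 2 ^ (4 + 2 * n) * (n ^ n * suc n ^ suc n)
[1+2n]^[1+2n]<2^[4+2n]*n^n*[1+n]^[1+n] zero        = m+o≡n⇒m≤n 14 refl
[1+2n]^[1+2n]<2^[4+2n]*n^n*[1+n]^[1+n] n@(suc _) = begin-strict
  x ^ x
    ≡⟨ cong (x *_) (trans (sym (^-*-assoc x 2 n)) (cong (_^ n) (x²≡1+y n))) ⟩
  x * suc y ^ n
    ≤⟨ *-monoʳ-≤ x ([1+4n[1+n]]^n≤8*[4n[1+n]]^n n) ⟩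
  x * (8 * y ^ n)
    <⟨ *-monoˡ-< (8 * y ^ n) {{m*n≢0 8 (y ^ n) {{_}} {{m^n≢0 y n}}}} (n<1+n x) ⟩
  suc x * (8 * y ^ n)
    ≡⟨ cong (λ z → suc x * (8 * z)) y^n≡2^[2n]*n^n*[1+n]^n ⟩
  suc x * (8 * (2 ^ (2 * n) * (n ^ n * suc n ^ n)))
    ≡⟨ regroup n (2 ^ (2 * n)) (n ^ n) (suc n ^ n) ⟩
  2 ^ 4 * 2 ^ (2 * n) * (n ^ n * suc n ^ suc n)
    ≡⟨ cong (_* (n ^ n * suc n ^ suc n)) (^-distribˡ-+-* 2 4 (2 * n)) ⟨
  2 ^ (4 + 2 * n) * (n ^ n * suc n ^ suc n) ∎
  where
  x y : ℕ
  x = suc (2 * n)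
  y = 4 * (n * suc n)
  y^n≡2^[2n]*n^n*[1+n]^n : y ^ n ≡ 2 ^ (2 * n) * (n ^ n * suc n ^ n)
  y^n≡2^[2n]*n^n*[1+n]^n = begin-equality
    (4 * (n * suc n)) ^ n       ≡⟨ ^-distribʳ-* 4 (n * suc n) n ⟩
    4 ^ n * (n * suc n) ^ n     ≡⟨ cong₂ _*_ (^-*-assoc 2 2 n) (^-distribʳ-* n (suc n) n) ⟩
    2 ^ (2 * n) * (n ^ n * suc n ^ n) ∎
  x²≡1+y : ∀ n → suc (2 * n) * (suc (2 * n) * 1) ≡ suc (4 * (n * suc n))
  x²≡1+y = solve-∀
  regroup : ∀ n q a b → suc (suc (2 * n)) * (8 * (q * (a * b))) ≡ 16 * q * (a * (suc n * b))
  regroup = solve-∀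

-- Here m = 2n + 1 and S = 3(m + 1).
TollGt2-consecutive : ∀ n → TollGt2 (n ∷ suc n ∷ []) (6 * suc n)
TollGt2-consecutive n = begin-strict
  2 ^ (2 * M) * M ^ M
    ≡⟨ cong (λ N → 2 ^ (2 * N) * N ^ N) (M≡1+2n n) ⟩
  2 ^ (2 * x) * x ^ x
    <⟨ *-monoʳ-< (2 ^ (2 * x)) {{m^n≢0 2 (2 * x)}} ([1+2n]^[1+2n]<2^[4+2n]*n^n*[1+n]^[1+n] n) ⟩
  2 ^ (2 * x) * (2 ^ (4 + 2 * n) * P)
    ≡⟨ *-assoc (2 ^ (2 * x)) (2 ^ (4 + 2 * n)) P ⟨
  2 ^ (2 * x) * 2 ^ (4 + 2 * n) * P
    ≡⟨ cong (_* P) (^-distribˡ-+-* 2 (2 * x) (4 + 2 * n)) ⟨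
  2 ^ (2 * x + (4 + 2 * n)) * P
    ≡⟨ cong₂ (λ e p → 2 ^ e * p) (exponent n) (cong (n ^ n *_) (*-identityʳ (suc n ^ suc n))) ⟨
  2 ^ (6 * suc n) * (n ^ n * (suc n ^ suc n * 1)) ∎
  where
  M x P : ℕ
  M = n + (suc n + 0)
  x = suc (2 * n)
  P = n ^ n * suc n ^ suc n
  M≡1+2n : ∀ n → n + (suc n + 0) ≡ suc (2 * n)
  M≡1+2n = solve-∀
  exponent : ∀ n → 6 * suc n ≡ 2 * suc (2 * n) + (4 + 2 * n)
  exponent = solve-∀

gcd[n,1+n]≡1 : ∀ n → gcd n (suc n) ≡ 1
gcd[n,1+n]≡1 n = coprime⇒gcd≡1 (subst (Coprime n) (+-comm n 1) (coprime-sym (coprime-+ (1-coprimeTo n))))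

2[1+O]<1+4O : ∀ {O} → 1 ≤ O → 2 * suc O < suc (4 * O)
2[1+O]<1+4O {suc o} _ = m+o≡n⇒m≤n _ (slack o)
  where
  slack : ∀ o → suc (2 * suc (suc o)) + 2 * o ≡ suc (4 * suc o)
  slack = solve-∀

[1+O]*3<1+4O : ∀ {O} → 3 ≤ O → suc O * 3 < suc (4 * O)
[1+O]*3<1+4O {suc (suc (suc o))} (s≤s (s≤s (s≤s _))) = m+o≡n⇒m≤n o (slack o)
  where
  slack : ∀ o → suc (suc (3 + o) * 3) + o ≡ suc (4 * (3 + o))
  slack = solve-∀

5+2O<1+4O : ∀ {O} → 3 ≤ O → 5 + 2 * O < suc (4 * O)
5+2O<1+4O {suc (suc (suc o))} (s≤s (s≤s (s≤s _))) = m+o≡n⇒m≤n _ (slack o)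
  where
  slack : ∀ o → suc (5 + 2 * (3 + o)) + (1 + 2 * o) ≡ suc (4 * (3 + o))
  slack = solve-∀

[1+O]*4[1+O]<[3+2O]*[1+4O] : ∀ {O} → 1 ≤ O → suc O * (4 * suc O) < (3 + 2 * O) * suc (4 * O)
[1+O]*4[1+O]<[3+2O]*[1+4O] {suc o} _ = m+o≡n⇒m≤n _ (slack o)
  where
  slack : ∀ o → suc (suc (suc o) * (4 * suc (suc o))) + (4 * o * o + 14 * o + 8)
              ≡ (3 + 2 * suc o) * suc (4 * suc o)
  slack = solve-∀

module Witness (r : ℕ) (2≤r : 2 ≤ r) where

  O n k : ℕ
  O = mersenne r
  n = 2 * O
  k = suc (suc r)

  as : List ℕ
  as = n ∷ suc n ∷ []

  3≤O : 3 ≤ O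
  3≤O = ≤-pred (subst (4 ≤_) (sym (suc-mersenne r)) (^-monoʳ-≤ 2 2≤r))

  2^r≡1+O : 2 ^ r ≡ suc O
  2^r≡1+O = sym (suc-mersenne r)

  m≡1+4O : sum as ≡ suc (4 * O)
  m≡1+4O = poly O
    where
    poly : ∀ O → 2 * O + (suc (2 * O) + 0) ≡ suc (4 * O)
    poly = solve-∀

  2^k≡4[1+O] : 2 ^ k ≡ 4 * suc O
  2^k≡4[1+O] = trans (cong (λ p → 2 * (2 * p)) 2^r≡1+O) (poly (suc O))
    where
    poly : ∀ p → 2 * (2 * p) ≡ 4 * p
    poly = solve-∀

  2^k≡m+3 : 2 ^ k ≡ sum as + 3
  2^k≡m+3 = trans 2^k≡4[1+O] (poly O)
    where
    poly : ∀ O → 4 * suc O ≡ 2 * O + (suc (2 * O) + 0) + 3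
    poly = solve-∀

  instance
    m≢0 : NonZero (sum as)
    m≢0 = subst NonZero (sym m≡1+4O) _

  positive : All (0 <_) as
  positive = *-monoʳ-< 2 (≤-trans (s≤s z≤n) 3≤O) ∷ z<s ∷ []

  gcd[as]≡1 : gcdList as ≡ 1
  gcd[as]≡1 = trans (cong (gcd n) (gcd-identityʳ (suc n))) (gcd[n,1+n]≡1 n)

  ⌈log₂m⌉≡k : ⌈log₂ sum as ⌉ ≡ k
  ⌈log₂m⌉≡k = ⌈log₂n⌉≡1+k (suc r)
    (subst₂ _<_ (sym (cong (2 *_) 2^r≡1+O)) (sym m≡1+4O) (2[1+O]<1+4O (≤-trans (s≤s z≤n) 3≤O)))
    (m+o≡n⇒m≤n 3 (sym 2^k≡m+3))

  T : ℕ
  T = scaledNu r O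

  scaledNu[1+r]O : scaledNu (suc r) O ≡ T + O
  scaledNu[1+r]O = begin-equality
    scaledNu (suc r) O  ≡⟨ cong (λ K → scaledNu K O) (+-comm 1 r) ⟩
    scaledNu (r + 1) O  ≡⟨ scaledNu-pad r 1 O (≤-reflexive (suc-mersenne r)) ⟩
    T + 1 * O           ≡⟨ cong (T +_) (*-identityˡ O) ⟩
    T + O               ∎

  fldrCostTimesM[as] : fldrCostTimesM as ≡ 6 * suc n
  fldrCostTimesM[as] = begin-equality
    fldrCostTimesM as
      ≡⟨ fldrCostTimesM-≡ as 3 ⌈log₂m⌉≡k 2^k≡m+3 ⟩
    scaledNu k 3 + (scaledNu k (0 + 2 * O) + (scaledNu k (1 + 2 * O) + 0))
      ≡⟨ cong₂ _+_ (scaledNu-3 (suc r) (s≤s z≤n))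
                   (cong₂ _+_ (scaledNu-suc (suc r) O z≤n) (cong (_+ 0) (scaledNu-suc (suc r) O (s≤s z≤n)))) ⟩
    3 * suc r + 1 + (2 * V + k * 0 + (2 * V + k * 1 + 0))
      ≡⟨ cong (λ v → 3 * suc r + 1 + (2 * v + k * 0 + (2 * v + k * 1 + 0))) scaledNu[1+r]O ⟩
    3 * suc r + 1 + (2 * (T + O) + k * 0 + (2 * (T + O) + k * 1 + 0))
      ≡⟨ regroup r T O ⟩
    4 * (T + r) + 4 * O + 6
      ≡⟨ cong (λ s → 4 * s + 4 * O + 6) (scaledNu-mersenne r) ⟩
    4 * (2 * O) + 4 * O + 6
      ≡⟨ collect O ⟩
    6 * suc n ∎
    where
    V : ℕ
    V = scaledNu (suc r) O
    -- r is left only inside T + r = 2O.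
    regroup : ∀ r T O → 3 * suc r + 1 + (2 * (T + O) + suc (suc r) * 0 + (2 * (T + O) + suc (suc r) * 1 + 0))
                      ≡ 4 * (T + r) + 4 * O + 6
    regroup = solve-∀
    collect : ∀ O → 4 * (2 * O) + 4 * O + 6 ≡ 6 * suc (2 * O)
    collect = solve-∀

  FLDRTollGt2[as] : FLDRTollGt2 as
  FLDRTollGt2[as] = subst (TollGt2 as) (sym fldrCostTimesM[as]) (TollGt2-consecutive n)

  ALDRTollGt2-below : ∀ j → j ≤ r → ALDRTollGt2 as (j + k)
  ALDRTollGt2-below j j≤r =
    subst (λ c → FLDRTollGt2 (map (c *_) as)) (sym cK≡2^j) (FLDRTollGt2-*2^ j as FLDRTollGt2[as])
    where
    2^[j+k]≡2^j*m+2^j*3 : 2 ^ (j + k) ≡ 2 ^ j * sum as + 2 ^ j * 3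
    2^[j+k]≡2^j*m+2^j*3 =
      trans (^-distribˡ-+-* 2 j k) (trans (cong (2 ^ j *_) 2^k≡m+3) (*-distribˡ-+ (2 ^ j) (sum as) 3))
    2^j*3<m : 2 ^ j * 3 < sum as
    2^j*3<m = ≤-trans (s≤s (*-monoˡ-≤ 3 (^-monoʳ-≤ 2 j≤r)))
                (subst₂ _<_ (cong (_* 3) (sym 2^r≡1+O)) (sym m≡1+4O) ([1+O]*3<1+4O 3≤O))
    cK≡2^j : cK (j + k) (sum as) ≡ 2 ^ j
    cK≡2^j = cK-≡ (2 ^ j) 2^[j+k]≡2^j*m+2^j*3 2^j*3<m

  -- At K = 2k − 1 the scale is c = c_K = 2^(r+1) + 1, and the three FLDR weights have short
  -- binary expansions: A₀ = 2^(r+1) + 3,  c·n = O·2^k + n  and  c·(n + 1) = 2^(2r+2) − 1.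
  c A₀ N X : ℕ
  c  = 3 + 2 * O
  A₀ = 5 + 2 * O
  N  = suc (suc (r + r))
  X  = mersenne N

  2^[1+r]≡2[1+O] : 2 ^ suc r ≡ 2 * suc O
  2^[1+r]≡2[1+O] = cong (2 *_) 2^r≡1+O

  2^[2k-1]≡2[1+O]*4[1+O] : 2 ^ (suc r + k) ≡ 2 * suc O * (4 * suc O)
  2^[2k-1]≡2[1+O]*4[1+O] = trans (^-distribˡ-+-* 2 (suc r) k) (cong₂ _*_ 2^[1+r]≡2[1+O] 2^k≡4[1+O])

  2^[2k-1]≡c*m+A₀ : 2 ^ (suc r + k) ≡ c * sum as + A₀
  2^[2k-1]≡c*m+A₀ = trans 2^[2k-1]≡2[1+O]*4[1+O] (poly O)
    where
    poly : ∀ O → 2 * suc O * (4 * suc O) ≡ (3 + 2 * O) * (2 * O + (suc (2 * O) + 0)) + (5 + 2 * O)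
    poly = solve-∀

  2^[2k-1]≡M+A₀ : 2 ^ (suc r + k) ≡ sum (map (c *_) as) + A₀
  2^[2k-1]≡M+A₀ = trans 2^[2k-1]≡2[1+O]*4[1+O] (poly O)
    where
    poly : ∀ O → 2 * suc O * (4 * suc O) ≡ (3 + 2 * O) * (2 * O) + ((3 + 2 * O) * suc (2 * O) + 0) + (5 + 2 * O)
    poly = solve-∀

  cK≡c : cK (suc r + k) (sum as) ≡ c
  cK≡c = cK-≡ c 2^[2k-1]≡c*m+A₀ (subst (A₀ <_) (sym m≡1+4O) (5+2O<1+4O 3≤O))

  ⌈log₂M⌉≡2k-1 : ⌈log₂ sum (map (c *_) as) ⌉ ≡ suc r + k
  ⌈log₂M⌉≡2k-1 = ⌈log₂n⌉≡1+k (r + k) 2^[2k-2]<M (m+o≡n⇒m≤n A₀ (sym 2^[2k-1]≡M+A₀))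
    where
    poly : ∀ O → (3 + 2 * O) * suc (4 * O) ≡ (3 + 2 * O) * (2 * O) + ((3 + 2 * O) * suc (2 * O) + 0)
    poly = solve-∀
    2^[2k-2]<M : 2 ^ (r + k) < sum (map (c *_) as)
    2^[2k-2]<M = begin-strict
      2 ^ (r + k)                 ≡⟨ ^-distribˡ-+-* 2 r k ⟩
      2 ^ r * 2 ^ k               ≡⟨ cong₂ _*_ 2^r≡1+O 2^k≡4[1+O] ⟩
      suc O * (4 * suc O)         <⟨ [1+O]*4[1+O]<[3+2O]*[1+4O] (≤-trans (s≤s z≤n) 3≤O) ⟩
      (3 + 2 * O) * suc (4 * O)   ≡⟨ poly O ⟩
      sum (map (c *_) as)         ∎

  X≡c*[1+n] : X ≡ c * suc n
  X≡c*[1+n] = suc-injective (begin-equality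
    suc X                              ≡⟨ suc-mersenne N ⟩
    2 * (2 * 2 ^ (r + r))              ≡⟨ cong (λ p → 2 * (2 * p)) (^-distribˡ-+-* 2 r r) ⟩
    2 * (2 * (2 ^ r * 2 ^ r))          ≡⟨ cong (λ p → 2 * (2 * (p * p))) 2^r≡1+O ⟩
    2 * (2 * (suc O * suc O))          ≡⟨ poly O ⟩
    suc (c * suc n)                    ∎)
    where
    poly : ∀ O → 2 * (2 * (suc O * suc O)) ≡ suc ((3 + 2 * O) * suc (2 * O))
    poly = solve-∀

  U : ℕ
  U = scaledNu N X

  scaledNu[A₀] : scaledNu (suc r + k) A₀ ≡ 2 * suc O * k + (3 * r + 1) + k * 3
  scaledNu[A₀] = begin-equality
    scaledNu (suc r + k) A₀
      ≡⟨ cong (scaledNu (suc r + k)) (trans (poly O) (cong (λ p → 1 * p + 3) (sym 2^[1+r]≡2[1+O]))) ⟩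
    scaledNu (suc r + k) (1 * 2 ^ suc r + 3)
      ≡⟨ scaledNu-split (suc r) k 1 3 3<2^[1+r] ⟩
    2 ^ suc r * scaledNu k 1 + scaledNu (suc r) 3 + k * 3
      ≡⟨ cong₂ (λ a b → a + b + k * 3) (cong₂ _*_ 2^[1+r]≡2[1+O] (scaledNu-1 (suc r)))
                                       (scaledNu-3 r (≤-trans (s≤s z≤n) 2≤r)) ⟩
    2 * suc O * k + (3 * r + 1) + k * 3 ∎
    where
    poly : ∀ O → 5 + 2 * O ≡ 1 * (2 * suc O) + 3
    poly = solve-∀
    3<2^[1+r] : 3 < 2 ^ suc r
    3<2^[1+r] = ≤-trans (m≤m+n 4 4) (^-monoʳ-≤ 2 (s≤s 2≤r))

  scaledNu[c*n] : scaledNu (suc r + k) (c * n) ≡ 4 * suc O * (T + O) + (2 * (T + O) + k * 0) + suc r * n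
  scaledNu[c*n] = begin-equality
    scaledNu (suc r + k) (c * n)
      ≡⟨ cong₂ scaledNu (+-comm (suc r) k) (trans (poly O) (cong (λ p → O * p + n) (sym 2^k≡4[1+O]))) ⟩
    scaledNu (k + suc r) (O * 2 ^ k + n)
      ≡⟨ scaledNu-split k (suc r) O n n<2^k ⟩
    2 ^ k * scaledNu (suc r) O + scaledNu k n + suc r * n
      ≡⟨ cong₂ (λ a b → a * scaledNu (suc r) O + b + suc r * n) 2^k≡4[1+O] (scaledNu-suc (suc r) O z≤n) ⟩
    4 * suc O * scaledNu (suc r) O + (2 * scaledNu (suc r) O + k * 0) + suc r * n
      ≡⟨ cong (λ v → 4 * suc O * v + (2 * v + k * 0) + suc r * n) scaledNu[1+r]O ⟩
    4 * suc O * (T + O) + (2 * (T + O) + k * 0) + suc r * n ∎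
    where
    poly : ∀ O → (3 + 2 * O) * (2 * O) ≡ O * (4 * suc O) + 2 * O
    poly = solve-∀
    slack : ∀ O → suc (2 * O) + (3 + 2 * O) ≡ 4 * suc O
    slack = solve-∀
    n<2^k : n < 2 ^ k
    n<2^k = subst (n <_) (sym 2^k≡4[1+O]) (m+o≡n⇒m≤n _ (slack O))

  scaledNu[c*[1+n]] : scaledNu (suc r + k) (c * suc n) ≡ U + 1 * X
  scaledNu[c*[1+n]] = begin-equality
    scaledNu (suc r + k) (c * suc n)  ≡⟨ cong₂ scaledNu (poly r) (sym X≡c*[1+n]) ⟩
    scaledNu (N + 1) X                ≡⟨ scaledNu-pad N 1 X (≤-reflexive (suc-mersenne N)) ⟩
    U + 1 * X                         ∎
    where
    poly : ∀ r → suc r + suc (suc r) ≡ suc (suc (r + r)) + 1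
    poly = solve-∀

  fldrCostTimesM[c*as] : fldrCostTimesM (map (c *_) as) ≡ c * (6 * suc n)
  fldrCostTimesM[c*as] = begin-equality
    fldrCostTimesM (map (c *_) as)
      ≡⟨ fldrCostTimesM-≡ (map (c *_) as) A₀ ⌈log₂M⌉≡2k-1 2^[2k-1]≡M+A₀ ⟩
    scaledNu (suc r + k) A₀ + (scaledNu (suc r + k) (c * n) + (scaledNu (suc r + k) (c * suc n) + 0))
      ≡⟨ cong₂ _+_ scaledNu[A₀] (cong₂ _+_ scaledNu[c*n] (cong (_+ 0) scaledNu[c*[1+n]])) ⟩
    2 * suc O * k + (3 * r + 1) + k * 3 + (4 * suc O * (T + O) + (2 * (T + O) + k * 0) + suc r * n + (U + 1 * X + 0))
      ≡⟨ regroup O r T U X ⟩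
    (4 * O + 6) * (T + r) + (U + N) + (c * c + X)
      ≡⟨ cong₂ (λ a b → (4 * O + 6) * a + b + (c * c + X)) (scaledNu-mersenne r) (scaledNu-mersenne N) ⟩
    (4 * O + 6) * (2 * O) + 2 * X + (c * c + X)
      ≡⟨ cong (λ x → (4 * O + 6) * (2 * O) + 2 * x + (c * c + x)) X≡c*[1+n] ⟩
    (4 * O + 6) * (2 * O) + 2 * (c * suc n) + (c * c + c * suc n)
      ≡⟨ collect O ⟩
    c * (6 * suc n) ∎
    where
    -- r is left only inside T + r = 2O and U + N = 2X.
    regroup : ∀ O r T U X →
      2 * suc O * suc (suc r) + (3 * r + 1) + suc (suc r) * 3
        + (4 * suc O * (T + O) + (2 * (T + O) + suc (suc r) * 0) + suc r * (2 * O) + (U + 1 * X + 0))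
      ≡ (4 * O + 6) * (T + r) + (U + suc (suc (r + r))) + ((3 + 2 * O) * (3 + 2 * O) + X)
    regroup = solve-∀
    collect : ∀ O →
      (4 * O + 6) * (2 * O) + 2 * ((3 + 2 * O) * suc (2 * O)) + ((3 + 2 * O) * (3 + 2 * O) + (3 + 2 * O) * suc (2 * O))
      ≡ (3 + 2 * O) * (6 * suc (2 * O))
    collect = solve-∀

  ALDRTollGt2-top : ALDRTollGt2 as (suc r + k)
  ALDRTollGt2-top = subst (λ c → FLDRTollGt2 (map (c *_) as)) (sym cK≡c)
    (subst (TollGt2 (map (c *_) as)) (sym fldrCostTimesM[c*as])
      (TollGt2-* c as (6 * suc n) (TollGt2-consecutive n)))

  ALDRTollGt2-range : ∀ K → k ≤ K → K < 2 * k → ALDRTollGt2 as K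
  ALDRTollGt2-range K k≤K K<2k = subst (ALDRTollGt2 as) (m∸n+n≡m k≤K) (at-offset (K ∸ k) K∸k≤1+r)
    where
    K∸k≤1+r : K ∸ k ≤ suc r
    K∸k≤1+r = ≤-pred (m<n+o⇒m∸n<o K k (subst (K <_) (cong (k +_) (+-identityʳ k)) K<2k))
    at-offset : ∀ j → j ≤ suc r → ALDRTollGt2 as (j + k)
    at-offset j j≤1+r with m≤n⇒m<n∨m≡n j≤1+r
    ... | inj₁ j<1+r = ALDRTollGt2-below j (≤-pred j<1+r)
    ... | inj₂ refl  = ALDRTollGt2-top

theorem4p18 : (k : ℕ) → 4 ≤ k →
    ∃ λ (as : List ℕ) →
      All (λ a → 0 < a) as × gcdList as ≡ 1 × ⌈log₂ sum as ⌉ ≡ k ×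
      ((K : ℕ) → k ≤ K → K < 2 * k → ALDRTollGt2 as K)
theorem4p18 (suc (suc r)) (s≤s (s≤s 2≤r)) = as , positive , gcd[as]≡1 , ⌈log₂m⌉≡k , ALDRTollGt2-range
  where open Witness r 2≤r
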